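{- Let $P$ be the $13$-element poset (the minimal finite model of the real projective plane $\mathbb{R}P^2$) with underlying set $\{n_1,n_2,n_3,a_1,\dots,a_6,m_1,\dots,m_4\}$, whose order is the reflexive–transitive closure of the covering relations $n_1<a_1,\ n_1<a_2,\ n_1<a_3,\ n_1<a_5$; $n_2<a_2,\ n_2<a_3,\ n_2<a_4,\ n_2<a_6$; $n_3<a_1,\ n_3<a_4,\ n_3<a_5,\ n_3<a_6$; $a_1<m_1,\ a_1<m_2$; $a_2<m_1,\ a_2<m_3$; $a_3<m_2,\ a_3<m_4$; $a_4<m_2,\ a_4<m_3$; $a_5<m_3,\ a_5<m_4$; $a_6<m_1,\ a_6<m_4$. Then $P$ is not conclusive.
   Context: Let $P$ be a finite poset and $k$ a commutative ring. A function $f$ defined on the pairs $(x,y)\in P\times P$ with $x\le y$, with values in $k$, is called transitive if $f(x,z)=f(x,y)+f(y,z)$ whenever $x\le y\le z$. It is called potential if there is a function $\varphi:P\to k$ with $f(x,y)=\varphi(y)-\varphi(x)$ for all $x\le y$. (Transitive functions correspond to derivations of the incidence algebra $I(P,k)$, potential ones to inner derivations.) The poset $P$ is soluble if for every commutative ring $k$ every transitive function $P\to k$ is potential; it is defective if for every nontrivial (nonzero) commutative ring $k$ there exists a transitive function $P\to k$ that is not potential. $P$ is conclusive if it is soluble or defective. -}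

module Defs where

open import Level using (0ℓ)
open import Data.Product using (Σ; ∃; _×_)
open import Data.Sum using (_⊎_)
open import Relation.Nullary using (¬_)
open import Relation.Binary.Construct.Closure.ReflexiveTransitive using (Star)
open import Algebra.Bundles using (CommutativeRing)

-- A function on the pairs x ≤ y is represented by a
-- total function A → A → Carrier whose values off the pairs x ≤ y are
-- irrelevant (all conditions are imposed only for x ≤ y).

module _ {A : Set} (_≤_ : A → A → Set) (k : CommutativeRing 0ℓ 0ℓ) where
  open CommutativeRing k

  IsTransitiveFun : (A → A → Carrier) → Set
  IsTransitiveFun f = ∀ x y z → x ≤ y → y ≤ z → f x z ≈ f x y + f y z

  IsPotentialFun : (A → A → Carrier) → Set
  IsPotentialFun f = Σ (A → Carrier) λ φ → ∀ x y → x ≤ y → f x y ≈ φ y - φ x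

Nontrivial : CommutativeRing 0ℓ 0ℓ → Set
Nontrivial k = ¬ (1# ≈ 0#) where open CommutativeRing k

module _ {A : Set} (_≤_ : A → A → Set) where
  Soluble : Set₁
  Soluble = (k : CommutativeRing 0ℓ 0ℓ) →
            (f : A → A → CommutativeRing.Carrier k) →
            IsTransitiveFun _≤_ k f → IsPotentialFun _≤_ k f

  Defective : Set₁
  Defective = (k : CommutativeRing 0ℓ 0ℓ) → Nontrivial k →
              Σ (A → A → CommutativeRing.Carrier k) λ f →
                IsTransitiveFun _≤_ k f × ¬ IsPotentialFun _≤_ k f

  Conclusive : Set₁
  Conclusive = Soluble ⊎ Defective

data RP2 : Set where
  n₁ n₂ n₃ a₁ a₂ a₃ a₄ a₅ a₆ m₁ m₂ m₃ m₄ : RP2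

data Cover : RP2 → RP2 → Set where
  n₁a₁ : Cover n₁ a₁
  n₁a₂ : Cover n₁ a₂
  n₁a₃ : Cover n₁ a₃
  n₁a₅ : Cover n₁ a₅
  n₂a₂ : Cover n₂ a₂
  n₂a₃ : Cover n₂ a₃
  n₂a₄ : Cover n₂ a₄
  n₂a₆ : Cover n₂ a₆
  n₃a₁ : Cover n₃ a₁
  n₃a₄ : Cover n₃ a₄
  n₃a₅ : Cover n₃ a₅
  n₃a₆ : Cover n₃ a₆
  a₁m₁ : Cover a₁ m₁
  a₁m₂ : Cover a₁ m₂
  a₂m₁ : Cover a₂ m₁
  a₂m₃ : Cover a₂ m₃
  a₃m₂ : Cover a₃ m₂
  a₃m₄ : Cover a₃ m₄
  a₄m₂ : Cover a₄ m₂
  a₄m₃ : Cover a₄ m₃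
  a₅m₃ : Cover a₅ m₃
  a₅m₄ : Cover a₅ m₄
  a₆m₁ : Cover a₆ m₁
  a₆m₄ : Cover a₆ m₄

_≤P_ : RP2 → RP2 → Set
_≤P_ = Star Cover

-- The Hasse diagram of P, with its twelve squares n < a, a′ < m as 2-cells, is a
-- cell structure on RP².  A transitive function is determined by its values on
-- covers, which are subject exactly to the square relations, so it is a 1-cocycle,
-- and it is potential exactly when that cocycle is a coboundary.  After
-- subtracting a coboundary the cocycle vanishes on a spanning tree, and the
-- square relations then force every remaining value to be ±u for a single u with
-- u + u = 0: transitive modulo potential functions is H¹(RP²; k) ≅ {u ∣ 2u = 0}.
-- Over 𝔽₂ the class u = 1 is a transitive function that is not potential, so P
-- is not soluble; ℤ has no 2-torsion, so P is not defective.
module Submission where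

open import Level using (0ℓ)
open import Algebra.Bundles using (CommutativeRing)
open import Data.Bool using (Bool; true; false; _xor_)
open import Data.Bool.Properties using (xor-∧-commutativeRing)
open import Data.Empty using (⊥-elim)
open import Data.Integer using (+_; +[1+_]; -[1+_])
open import Data.Integer.Properties using (+-*-commutativeRing)
open import Data.Product using (_,_)
open import Data.Sum using ([_,_]′)
open import Relation.Binary.Construct.Closure.ReflexiveTransitive using (Star; ε; _◅_; return)
open import Relation.Binary.PropositionalEquality using (_≡_; refl)
open import Relation.Nullary using (¬_)

open import Defs

TwoTorsionFree : CommutativeRing 0ℓ 0ℓ → Set
TwoTorsionFree k = ∀ x → x + x ≈ 0# → x ≈ 0#
  where open CommutativeRing k

module _ (k : CommutativeRing 0ℓ 0ℓ) where
  open CommutativeRing k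
  open import Algebra.Properties.AbelianGroup +-abelianGroup
  open import Algebra.Properties.CommutativeSemigroup +-commutativeSemigroup using (interchange)
  open import Relation.Binary.Reasoning.Setoid setoid

  telescope : ∀ x y z → (y - x) + (z - y) ≈ z - x
  telescope x y z = begin
    (y - x) + (z - y)     ≈⟨ +-comm (y - x) (z - y) ⟩
    (z - y) + (y - x)     ≈⟨ +-assoc z (- y) (y - x) ⟩
    z + (- y + (y - x))   ≈⟨ +-congˡ (\\-leftDividesʳ y (- x)) ⟩
    z - x                 ∎

  -‿interchange : ∀ x y z w → (x - y) + (z - w) ≈ (x + z) - (y + w)
  -‿interchange x y z w = begin
    (x - y) + (z - w)     ≈⟨ interchange x (- y) z (- w) ⟩
    (x + z) + (- y - w)   ≈⟨ +-congˡ (⁻¹-∙-comm y w) ⟩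
    (x + z) - (y + w)     ∎

  x-0≈x : ∀ x → x - 0# ≈ x
  x-0≈x x = trans (+-congˡ ε⁻¹≈ε) (+-identityʳ x)

  x-[x-y]≈y : ∀ x y → x - (x - y) ≈ y
  x-[x-y]≈y x y = begin
    x - (x - y)   ≈⟨ +-congˡ (⁻¹-anti-homo‿- x y) ⟩
    x + (y - x)   ≈⟨ +-assoc x y (- x) ⟨
    (x + y) - x   ≈⟨ xyx⁻¹≈y x y ⟩
    y             ∎

  +-cancel-≈0ʳ : ∀ {x y z w} → y ≈ 0# → w ≈ 0# → x + y ≈ z + w → x ≈ z
  +-cancel-≈0ʳ {x} {y} {z} {w} y≈0 w≈0 x+y≈z+w = begin
    x        ≈⟨ +-identityʳ x ⟨
    x + 0#   ≈⟨ +-congˡ y≈0 ⟨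
    x + y    ≈⟨ x+y≈z+w ⟩
    z + w    ≈⟨ +-congˡ w≈0 ⟩
    z + 0#   ≈⟨ +-identityʳ z ⟩
    z        ∎

  +-cancel-≈0ˡ : ∀ {x y z w} → x ≈ 0# → z ≈ 0# → x + y ≈ z + w → y ≈ w
  +-cancel-≈0ˡ {x} {y} {z} {w} x≈0 z≈0 x+y≈z+w =
    +-cancel-≈0ʳ x≈0 z≈0 (trans (+-comm y x) (trans x+y≈z+w (+-comm z w)))

  +-cancel-≈0-outer : ∀ {x y z w} → x ≈ 0# → w ≈ 0# → x + y ≈ z + w → y ≈ z
  +-cancel-≈0-outer {x} {y} x≈0 w≈0 x+y≈z+w = +-cancel-≈0ʳ x≈0 w≈0 (trans (+-comm y x) x+y≈z+w)

  module _ {A : Set} {_≤_ : A → A → Set} {f : A → A → Carrier} where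

    transitive⇒refl≈0 : IsTransitiveFun _≤_ k f → ∀ {x} → x ≤ x → f x x ≈ 0#
    transitive⇒refl≈0 transitive {x} x≤x =
      identityˡ-unique (f x x) (f x x) (sym (transitive x x x x≤x x≤x))

    transitive-minus-coboundary : IsTransitiveFun _≤_ k f → (φ : A → Carrier) →
                                  IsTransitiveFun _≤_ k (λ x y → f x y - (φ y - φ x))
    transitive-minus-coboundary transitive φ x y z x≤y y≤z = begin
      f x z - (φ z - φ x)
        ≈⟨ +-congʳ (transitive x y z x≤y y≤z) ⟩
      (f x y + f y z) - (φ z - φ x)
        ≈⟨ +-congˡ (-‿cong (telescope (φ x) (φ y) (φ z))) ⟨
      (f x y + f y z) - ((φ y - φ x) + (φ z - φ y))
        ≈⟨ -‿interchange (f x y) (φ y - φ x) (f y z) (φ z - φ y) ⟨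
      (f x y - (φ y - φ x)) + (f y z - (φ z - φ y))
        ∎

    potential⇒cycle-balanced : IsPotentialFun _≤_ k f → ∀ {x y x′ y′} →
                               x ≤ y → x′ ≤ y → x′ ≤ y′ → x ≤ y′ →
                               f x y + f x′ y′ ≈ f x′ y + f x y′
    potential⇒cycle-balanced (φ , exact) {x} {y} {x′} {y′} x≤y x′≤y x′≤y′ x≤y′ = begin
      f x y + f x′ y′               ≈⟨ +-cong (exact x y x≤y) (exact x′ y′ x′≤y′) ⟩
      (φ y - φ x) + (φ y′ - φ x′)   ≈⟨ -‿interchange (φ y) (φ x) (φ y′) (φ x′) ⟩
      (φ y + φ y′) - (φ x + φ x′)   ≈⟨ +-congˡ (-‿cong (+-comm (φ x) (φ x′))) ⟩
      (φ y + φ y′) - (φ x′ + φ x)   ≈⟨ -‿interchange (φ y) (φ x′) (φ y′) (φ x) ⟨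
      (φ y - φ x′) + (φ y′ - φ x)   ≈⟨ +-cong (exact x′ y x′≤y) (exact x y′ x≤y′) ⟨
      f x′ y + f x y′               ∎

  module _ {A : Set} {R : A → A → Set} {f : A → A → Carrier} where

    potential-from-generators : IsTransitiveFun (Star R) k f → (φ : A → Carrier) →
                                (∀ {x y} → R x y → f x y ≈ φ y - φ x) →
                                IsPotentialFun (Star R) k f
    potential-from-generators transitive φ exact = φ , λ _ _ → go
      where
      go : ∀ {x y} → Star R x y → f x y ≈ φ y - φ x
      go {x} ε = trans (transitive⇒refl≈0 transitive ε) (sym (-‿inverseʳ (φ x)))
      go {x} {z} (_◅_ {j = y} r rs) = begin
        f x z                       ≈⟨ transitive x y z (return r) rs ⟩
        f x y + f y z               ≈⟨ +-cong (exact r) (go rs) ⟩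
        (φ y - φ x) + (φ z - φ y)   ≈⟨ telescope (φ x) (φ y) (φ z) ⟩
        φ z - φ x                   ∎

    transitive-from-generators : (∀ {x y z w} → R x y → R y z → ¬ R z w) →
                                 (∀ x → f x x ≈ 0#) →
                                 (∀ {x y z} → R x y → R y z → f x z ≈ f x y + f y z) →
                                 IsTransitiveFun (Star R) k f
    transitive-from-generators _ refl≈0 _ x _ z ε _ =
      sym (trans (+-congʳ (refl≈0 x)) (+-identityˡ (f x z)))
    transitive-from-generators _ refl≈0 _ x y _ _ ε =
      sym (trans (+-congˡ (refl≈0 y)) (+-identityʳ (f x y)))
    transitive-from-generators _ _ square _ _ _ (r ◅ ε) (s ◅ ε) = square r s
    transitive-from-generators no-chain _ _ _ _ _ (r ◅ ε) (s ◅ t ◅ _) = ⊥-elim (no-chain r s t)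
    transitive-from-generators no-chain _ _ _ _ _ (r ◅ s ◅ ε) (t ◅ _) = ⊥-elim (no-chain r s t)
    transitive-from-generators no-chain _ _ _ _ _ (r ◅ s ◅ t ◅ _) _ = ⊥-elim (no-chain r s t)

no-chain-of-three-covers : ∀ {x y z w} → Cover x y → Cover y z → ¬ Cover z w
no-chain-of-three-covers () n₁a₁ _
no-chain-of-three-covers () n₁a₂ _
no-chain-of-three-covers () n₁a₃ _
no-chain-of-three-covers () n₁a₅ _
no-chain-of-three-covers () n₂a₂ _
no-chain-of-three-covers () n₂a₃ _
no-chain-of-three-covers () n₂a₄ _
no-chain-of-three-covers () n₂a₆ _
no-chain-of-three-covers () n₃a₁ _
no-chain-of-three-covers () n₃a₄ _
no-chain-of-three-covers () n₃a₅ _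
no-chain-of-three-covers () n₃a₆ _
no-chain-of-three-covers _ a₁m₁ ()
no-chain-of-three-covers _ a₁m₂ ()
no-chain-of-three-covers _ a₂m₁ ()
no-chain-of-three-covers _ a₂m₃ ()
no-chain-of-three-covers _ a₃m₂ ()
no-chain-of-three-covers _ a₃m₄ ()
no-chain-of-three-covers _ a₄m₂ ()
no-chain-of-three-covers _ a₄m₃ ()
no-chain-of-three-covers _ a₅m₃ ()
no-chain-of-three-covers _ a₅m₄ ()
no-chain-of-three-covers _ a₆m₁ ()
no-chain-of-three-covers _ a₆m₄ ()

data SpanningTree : RP2 → RP2 → Set where
  n₁a₁ : SpanningTree n₁ a₁
  n₁a₂ : SpanningTree n₁ a₂
  n₁a₃ : SpanningTree n₁ a₃
  n₁a₅ : SpanningTree n₁ a₅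
  a₁m₁ : SpanningTree a₁ m₁
  a₁m₂ : SpanningTree a₁ m₂
  a₂m₃ : SpanningTree a₂ m₃
  a₃m₄ : SpanningTree a₃ m₄
  n₂a₂ : SpanningTree n₂ a₂
  n₃a₁ : SpanningTree n₃ a₁
  a₄m₂ : SpanningTree a₄ m₂
  a₆m₁ : SpanningTree a₆ m₁

module _ (k : CommutativeRing 0ℓ 0ℓ) where
  open CommutativeRing k
  open import Algebra.Properties.AbelianGroup +-abelianGroup using (xyx⁻¹≈y; x∙y⁻¹≈ε⇒x≈y; x≈y⇒x∙y⁻¹≈ε)
  open import Relation.Binary.Reasoning.Setoid setoid

  vanishes-on-tree⇒vanishes-on-covers : TwoTorsionFree k → ∀ {d} → IsTransitiveFun _≤P_ k d →
                              (∀ {x y} → SpanningTree x y → d x y ≈ 0#) →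
                              ∀ {x y} → Cover x y → d x y ≈ 0#
  vanishes-on-tree⇒vanishes-on-covers two-torsion-free {d} transitive tree = vanishes
    where
    square : ∀ {n a a′ m} → Cover n a → Cover a m → Cover n a′ → Cover a′ m →
             d n a + d a m ≈ d n a′ + d a′ m
    square na am na′ a′m =
      trans (sym (transitive _ _ _ (return na) (return am))) (transitive _ _ _ (return na′) (return a′m))

    ≈0-along : ∀ {x y} → x ≈ 0# → x ≈ y → y ≈ 0#
    ≈0-along x≈0 x≈y = trans (sym x≈y) x≈0

    a₂m₁≈0 : d a₂ m₁ ≈ 0#
    a₂m₁≈0 = ≈0-along (tree a₁m₁) (+-cancel-≈0ˡ k (tree n₁a₁) (tree n₁a₂) (square n₁a₁ a₁m₁ n₁a₂ a₂m₁))
    a₃m₂≈0 : d a₃ m₂ ≈ 0#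
    a₃m₂≈0 = ≈0-along (tree a₁m₂) (+-cancel-≈0ˡ k (tree n₁a₁) (tree n₁a₃) (square n₁a₁ a₁m₂ n₁a₃ a₃m₂))
    a₅m₃≈0 : d a₅ m₃ ≈ 0#
    a₅m₃≈0 = ≈0-along (tree a₂m₃) (+-cancel-≈0ˡ k (tree n₁a₂) (tree n₁a₅) (square n₁a₂ a₂m₃ n₁a₅ a₅m₃))
    a₅m₄≈0 : d a₅ m₄ ≈ 0#
    a₅m₄≈0 = ≈0-along (tree a₃m₄) (+-cancel-≈0ˡ k (tree n₁a₃) (tree n₁a₅) (square n₁a₃ a₃m₄ n₁a₅ a₅m₄))
    n₂a₆≈0 : d n₂ a₆ ≈ 0#
    n₂a₆≈0 = ≈0-along (tree n₂a₂) (+-cancel-≈0ʳ k a₂m₁≈0 (tree a₆m₁) (square n₂a₂ a₂m₁ n₂a₆ a₆m₁))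
    n₃a₆≈0 : d n₃ a₆ ≈ 0#
    n₃a₆≈0 = ≈0-along (tree n₃a₁) (+-cancel-≈0ʳ k (tree a₁m₁) (tree a₆m₁) (square n₃a₁ a₁m₁ n₃a₆ a₆m₁))
    n₃a₄≈0 : d n₃ a₄ ≈ 0#
    n₃a₄≈0 = ≈0-along (tree n₃a₁) (+-cancel-≈0ʳ k (tree a₁m₂) (tree a₄m₂) (square n₃a₁ a₁m₂ n₃a₄ a₄m₂))

    n₂a₃≈n₂a₄ : d n₂ a₃ ≈ d n₂ a₄
    n₂a₃≈n₂a₄ = +-cancel-≈0ʳ k a₃m₂≈0 (tree a₄m₂) (square n₂a₃ a₃m₂ n₂a₄ a₄m₂)
    a₆m₄≈n₂a₃ : d a₆ m₄ ≈ d n₂ a₃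
    a₆m₄≈n₂a₃ = +-cancel-≈0-outer k n₂a₆≈0 (tree a₃m₄) (square n₂a₆ a₆m₄ n₂a₃ a₃m₄)
    a₆m₄≈n₃a₅ : d a₆ m₄ ≈ d n₃ a₅
    a₆m₄≈n₃a₅ = +-cancel-≈0-outer k n₃a₆≈0 a₅m₄≈0 (square n₃a₆ a₆m₄ n₃a₅ a₅m₄)
    a₄m₃≈n₃a₅ : d a₄ m₃ ≈ d n₃ a₅
    a₄m₃≈n₃a₅ = +-cancel-≈0-outer k n₃a₄≈0 a₅m₃≈0 (square n₃a₄ a₄m₃ n₃a₅ a₅m₃)
    n₂a₃≈a₄m₃ : d n₂ a₃ ≈ d a₄ m₃
    n₂a₃≈a₄m₃ = trans (sym a₆m₄≈n₂a₃) (trans a₆m₄≈n₃a₅ (sym a₄m₃≈n₃a₅))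

    n₂a₃≈0 : d n₂ a₃ ≈ 0#
    n₂a₃≈0 = two-torsion-free (d n₂ a₃) (begin
      d n₂ a₃ + d n₂ a₃   ≈⟨ +-cong n₂a₃≈n₂a₄ n₂a₃≈a₄m₃ ⟩
      d n₂ a₄ + d a₄ m₃   ≈⟨ square n₂a₂ a₂m₃ n₂a₄ a₄m₃ ⟨
      d n₂ a₂ + d a₂ m₃   ≈⟨ +-cong (tree n₂a₂) (tree a₂m₃) ⟩
      0# + 0#             ≈⟨ +-identityʳ 0# ⟩
      0#                  ∎)

    a₆m₄≈0 : d a₆ m₄ ≈ 0#
    a₆m₄≈0 = trans a₆m₄≈n₂a₃ n₂a₃≈0
    n₃a₅≈0 : d n₃ a₅ ≈ 0#
    n₃a₅≈0 = ≈0-along a₆m₄≈0 a₆m₄≈n₃a₅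

    vanishes : ∀ {x y} → Cover x y → d x y ≈ 0#
    vanishes n₁a₁ = tree n₁a₁
    vanishes n₁a₂ = tree n₁a₂
    vanishes n₁a₃ = tree n₁a₃
    vanishes n₁a₅ = tree n₁a₅
    vanishes n₂a₂ = tree n₂a₂
    vanishes n₂a₃ = n₂a₃≈0
    vanishes n₂a₄ = ≈0-along n₂a₃≈0 n₂a₃≈n₂a₄
    vanishes n₂a₆ = n₂a₆≈0
    vanishes n₃a₁ = tree n₃a₁
    vanishes n₃a₄ = n₃a₄≈0
    vanishes n₃a₅ = n₃a₅≈0
    vanishes n₃a₆ = n₃a₆≈0
    vanishes a₁m₁ = tree a₁m₁
    vanishes a₁m₂ = tree a₁m₂
    vanishes a₂m₁ = a₂m₁≈0
    vanishes a₂m₃ = tree a₂m₃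
    vanishes a₃m₂ = a₃m₂≈0
    vanishes a₃m₄ = tree a₃m₄
    vanishes a₄m₂ = tree a₄m₂
    vanishes a₄m₃ = trans a₄m₃≈n₃a₅ n₃a₅≈0
    vanishes a₅m₃ = a₅m₃≈0
    vanishes a₅m₄ = a₅m₄≈0
    vanishes a₆m₁ = tree a₆m₁
    vanishes a₆m₄ = a₆m₄≈0

  primitive-along-tree : (RP2 → RP2 → Carrier) → RP2 → Carrier
  primitive-along-tree f n₁ = 0#
  primitive-along-tree f a₁ = f n₁ a₁
  primitive-along-tree f a₂ = f n₁ a₂
  primitive-along-tree f a₃ = f n₁ a₃
  primitive-along-tree f a₅ = f n₁ a₅
  primitive-along-tree f m₁ = f n₁ a₁ + f a₁ m₁
  primitive-along-tree f m₂ = f n₁ a₁ + f a₁ m₂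
  primitive-along-tree f m₃ = f n₁ a₂ + f a₂ m₃
  primitive-along-tree f m₄ = f n₁ a₃ + f a₃ m₄
  primitive-along-tree f n₂ = f n₁ a₂ - f n₂ a₂
  primitive-along-tree f n₃ = f n₁ a₁ - f n₃ a₁
  primitive-along-tree f a₄ = (f n₁ a₁ + f a₁ m₂) - f a₄ m₂
  primitive-along-tree f a₆ = (f n₁ a₁ + f a₁ m₁) - f a₆ m₁

  primitive-along-tree-exact : ∀ f {x y} → SpanningTree x y →
                               primitive-along-tree f y - primitive-along-tree f x ≈ f x y
  primitive-along-tree-exact f n₁a₁ = x-0≈x k _
  primitive-along-tree-exact f n₁a₂ = x-0≈x k _
  primitive-along-tree-exact f n₁a₃ = x-0≈x k _
  primitive-along-tree-exact f n₁a₅ = x-0≈x k _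
  primitive-along-tree-exact f a₁m₁ = xyx⁻¹≈y _ _
  primitive-along-tree-exact f a₁m₂ = xyx⁻¹≈y _ _
  primitive-along-tree-exact f a₂m₃ = xyx⁻¹≈y _ _
  primitive-along-tree-exact f a₃m₄ = xyx⁻¹≈y _ _
  primitive-along-tree-exact f n₂a₂ = x-[x-y]≈y k _ _
  primitive-along-tree-exact f n₃a₁ = x-[x-y]≈y k _ _
  primitive-along-tree-exact f a₄m₂ = x-[x-y]≈y k _ _
  primitive-along-tree-exact f a₆m₁ = x-[x-y]≈y k _ _

  transitive⇒potential : TwoTorsionFree k → ∀ {f} → IsTransitiveFun _≤P_ k f → IsPotentialFun _≤P_ k f
  transitive⇒potential two-torsion-free {f} transitive =
    potential-from-generators k transitive φ λ c → x∙y⁻¹≈ε⇒x≈y _ _ (normalised-vanishes c)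
    where
    φ : RP2 → Carrier
    φ = primitive-along-tree f
    normalised-vanishes : ∀ {x y} → Cover x y → f x y - (φ y - φ x) ≈ 0#
    normalised-vanishes =
      vanishes-on-tree⇒vanishes-on-covers two-torsion-free (transitive-minus-coboundary k transitive φ)
        λ e → x≈y⇒x∙y⁻¹≈ε (sym (primitive-along-tree-exact f e))

-- The cocycle with u = true in the normal form of vanishes-on-tree⇒vanishes-on-covers
-- (false on SpanningTree), extended to pairs n < m by summing along either path.
xor-cocycle : RP2 → RP2 → Bool
xor-cocycle n₂ a₃ = true
xor-cocycle n₂ a₄ = true
xor-cocycle n₃ a₅ = true
xor-cocycle a₄ m₃ = true
xor-cocycle a₆ m₄ = true
xor-cocycle n₂ m₂ = true
xor-cocycle n₂ m₄ = true
xor-cocycle n₃ m₃ = true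
xor-cocycle n₃ m₄ = true
xor-cocycle _  _  = false

xor-cocycle-refl : ∀ x → xor-cocycle x x ≡ false
xor-cocycle-refl n₁ = refl
xor-cocycle-refl n₂ = refl
xor-cocycle-refl n₃ = refl
xor-cocycle-refl a₁ = refl
xor-cocycle-refl a₂ = refl
xor-cocycle-refl a₃ = refl
xor-cocycle-refl a₄ = refl
xor-cocycle-refl a₅ = refl
xor-cocycle-refl a₆ = refl
xor-cocycle-refl m₁ = refl
xor-cocycle-refl m₂ = refl
xor-cocycle-refl m₃ = refl
xor-cocycle-refl m₄ = refl

xor-cocycle-square : ∀ {x y z} → Cover x y → Cover y z →
                     xor-cocycle x z ≡ xor-cocycle x y xor xor-cocycle y z
xor-cocycle-square n₁a₁ a₁m₁ = refl
xor-cocycle-square n₁a₁ a₁m₂ = refl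
xor-cocycle-square n₁a₂ a₂m₁ = refl
xor-cocycle-square n₁a₂ a₂m₃ = refl
xor-cocycle-square n₁a₃ a₃m₂ = refl
xor-cocycle-square n₁a₃ a₃m₄ = refl
xor-cocycle-square n₁a₅ a₅m₃ = refl
xor-cocycle-square n₁a₅ a₅m₄ = refl
xor-cocycle-square n₂a₂ a₂m₁ = refl
xor-cocycle-square n₂a₂ a₂m₃ = refl
xor-cocycle-square n₂a₃ a₃m₂ = refl
xor-cocycle-square n₂a₃ a₃m₄ = refl
xor-cocycle-square n₂a₄ a₄m₂ = refl
xor-cocycle-square n₂a₄ a₄m₃ = refl
xor-cocycle-square n₂a₆ a₆m₁ = refl
xor-cocycle-square n₂a₆ a₆m₄ = refl
xor-cocycle-square n₃a₁ a₁m₁ = refl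
xor-cocycle-square n₃a₁ a₁m₂ = refl
xor-cocycle-square n₃a₄ a₄m₂ = refl
xor-cocycle-square n₃a₄ a₄m₃ = refl
xor-cocycle-square n₃a₅ a₅m₃ = refl
xor-cocycle-square n₃a₅ a₅m₄ = refl
xor-cocycle-square n₃a₆ a₆m₁ = refl
xor-cocycle-square n₃a₆ a₆m₄ = refl

xor-cocycle-transitive : IsTransitiveFun _≤P_ xor-∧-commutativeRing xor-cocycle
xor-cocycle-transitive =
  transitive-from-generators xor-∧-commutativeRing no-chain-of-three-covers xor-cocycle-refl xor-cocycle-square

xor-cocycle-not-potential : ¬ IsPotentialFun _≤P_ xor-∧-commutativeRing xor-cocycle
-- Around the loop n₁ < a₁ > n₃ < a₅ > n₁ only n₃ < a₅ carries true, so the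
-- balance equation reduces to true ≡ false.
xor-cocycle-not-potential potential
  with potential⇒cycle-balanced xor-∧-commutativeRing potential
         (return n₁a₁) (return n₃a₁) (return n₃a₅) (return n₁a₅)
... | ()

ℤ-two-torsion-free : TwoTorsionFree +-*-commutativeRing
ℤ-two-torsion-free (+ 0)    _  = refl
ℤ-two-torsion-free +[1+ _ ] ()
ℤ-two-torsion-free -[1+ _ ] ()

not-soluble : ¬ Soluble _≤P_
not-soluble soluble =
  xor-cocycle-not-potential (soluble xor-∧-commutativeRing xor-cocycle xor-cocycle-transitive)

not-defective : ¬ Defective _≤P_
not-defective defective with defective +-*-commutativeRing (λ ())
... | _ , transitive , not-potential =
  not-potential (transitive⇒potential +-*-commutativeRing ℤ-two-torsion-free transitive)

mainTheorem1 : ¬ Conclusive _≤P_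
mainTheorem1 = [ not-soluble , not-defective ]′
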